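{- $\mathbf{R}$-healthy predicates form a weak unital quantale: for $\mathbf{R}$-healthy $P, Q$ and any non-empty set $A$ of $\mathbf{R}$-healthy predicates (with $\mathbf{R}(\bigvee A)$ denoting the infimum of $A$ in the lattice of $\mathbf{R}$-healthy predicates), $P ; \mathbf{R}(\bigvee A) = \mathbf{R}(\bigvee \{P ; Q \mid Q \in A\})$ (Q1), $\mathbf{R}(\bigvee A) ; Q = \mathbf{R}(\bigvee \{P ; Q \mid P \in A\})$ (Q2), and $P ; \mathit{II} = \mathit{II} ; P = P$ (Q3).
   Context: Setting: Unifying Theories of Programming (UTP). Programs are relational predicates over unprimed (before) and primed (after) observational variables; sequential composition is $P ; Q \equiv \exists x_0.\ P[x_0/x'] \wedge Q[x_0/x]$, and $\mathit{II}$ is the relational identity. Refinement $P \sqsubseteq Q$ means $Q \Rightarrow P$ universally; the refinement infimum of predicates is their disjunction. Observational variables are $wait, wait' : \mathbb{B}$ and $tr, tr' : \mathcal{T}$, where $(\mathcal{T}, \frown, \varepsilon)$ is a trace algebra: associative $\frown$ with two-sided unit $\varepsilon$, left- and right-cancellative, and $x \frown y = \varepsilon \Rightarrow x = \varepsilon$. Prefix is $x \le y \iff \exists z.\ y = x \frown z$; subtraction $y - x$ is the unique $z$ with $y = x \frown z$ if $x \le y$, else $\varepsilon$. $P \lhd b \rhd Q \equiv (b \wedge P) \vee (\neg b \wedge Q)$. Healthiness conditions: $\mathbf{R1}(P) = P \wedge tr \le tr'$; $\mathbf{R2}_c(P) = P[\varepsilon, tr' - tr / tr, tr'] \lhd tr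 \le tr' \rhd P$; $\mathbf{R3}(P) = \mathit{II} \lhd wait \rhd P$; $\mathbf{R} = \mathbf{R3} \circ \mathbf{R2}_c \circ \mathbf{R1}$. The $\mathbf{R}$-healthy predicates form a complete lattice under $\sqsubseteq$ whose infimum of $A$ is $\mathbf{R}(\bigvee A)$. -}

module Defs where

open import Data.Bool using (Bool; true; false)
open import Data.Product using (Σ; ∃; ∃-syntax; _×_; _,_)
open import Data.Sum using (_⊎_)
open import Relation.Nullary using (¬_)
open import Relation.Binary.PropositionalEquality using (_≡_)

-- Subtraction y - x is supplied
-- together with its specification (it is the unique z with y = x ⌢ z when
-- x ≤ y, uniqueness following from left-cancellativity; else ε).
record TraceAlgebra : Set₁ where
  infixr 6 _⌢_
  infixl 6 _-_
  field
    Carrier   : Set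
    _⌢_       : Carrier → Carrier → Carrier
    ε         : Carrier
    ⌢-assoc   : ∀ x y z → (x ⌢ y) ⌢ z ≡ x ⌢ (y ⌢ z)
    ⌢-identityˡ : ∀ x → ε ⌢ x ≡ x
    ⌢-identityʳ : ∀ x → x ⌢ ε ≡ x
    ⌢-cancelˡ : ∀ x y z → x ⌢ y ≡ x ⌢ z → y ≡ z
    ⌢-cancelʳ : ∀ x y z → x ⌢ z ≡ y ⌢ z → x ≡ y
    ⌢-ε       : ∀ x y → x ⌢ y ≡ ε → x ≡ ε

  _≤_ : Carrier → Carrier → Set
  x ≤ y = ∃[ z ] (y ≡ x ⌢ z)

  field
    _-_       : Carrier → Carrier → Carrier
    -‿≤       : ∀ x y → x ≤ y → y ≡ x ⌢ (y - x)
    -‿≰       : ∀ x y → ¬ (x ≤ y) → y - x ≡ ε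

module UTP (T : TraceAlgebra) where
  open TraceAlgebra T

  record State : Set where
    constructor st
    field
      wait : Bool
      tr   : Carrier
  open State public

  Pred : Set₁
  Pred = State → State → Set

  _≐_ : Pred → Pred → Set
  P ≐ Q = ∀ s s' → (P s s' → Q s s') × (Q s s' → P s s')

  _⊑_ : Pred → Pred → Set
  P ⊑ Q = ∀ s s' → Q s s' → P s s'

  _⨾_ : Pred → Pred → Pred
  (P ⨾ Q) s s' = ∃[ s₀ ] (P s s₀ × Q s₀ s')

  II : Pred
  II s s' = s' ≡ s

  cond : Pred → Pred → Pred → Pred
  cond P b Q s s' = (b s s' × P s s') ⊎ (¬ b s s' × Q s s')

  ⋁ : {I : Set} → (I → Pred) → Pred
  ⋁ {I} A s s' = Σ I λ i → A i s s'

  R1 : Pred → Pred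
  R1 P s s' = P s s' × (tr s ≤ tr s')

  R2c : Pred → Pred
  R2c P = cond (λ s s' → P (st (wait s) ε) (st (wait s') (tr s' - tr s)))
               (λ s s' → tr s ≤ tr s')
               P

  R3 : Pred → Pred
  R3 P = cond II (λ s s' → wait s ≡ true) P

  R : Pred → Pred
  R P = R3 (R2c (R1 P))

  IsR : Pred → Set
  IsR P = R P ≐ P

-- R-healthiness is equivalent to three pointwise conditions on a relation: while
-- waiting it is the identity (R3), the trace only grows (R1), and it is invariant
-- under prefixing both traces by a common trace (R2).  All three are preserved by
-- sequential composition and by non-empty disjunction, so for healthy A the
-- infimum R (⋁ A) is just ⋁ A, and Q1, Q2 reduce to distributivity of ⨾ over ⋁.
-- Q3 holds for every relation.
module Submission where

open import Defs
open import Data.Bool using (true; false)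
open import Data.Empty using (⊥-elim)
open import Data.Product using (_×_; _,_; proj₁; proj₂; swap)
open import Data.Sum using (inj₁; inj₂)
open import Function using (id; _∘_; _⇔_; mk⇔; Equivalence)
open import Level using (0ℓ) renaming (suc to lsuc)
open import Relation.Binary.Bundles using (Setoid)
open import Relation.Binary.Structures using (IsEquivalence)
open import Relation.Binary.PropositionalEquality
  using (_≡_; refl; sym; trans; subst; subst₂)

module TraceAlgebraProperties (T : TraceAlgebra) where
  open TraceAlgebra T

  ≤-refl : ∀ {x} → x ≤ x
  ≤-refl {x} = ε , sym (⌢-identityʳ x)

  ≤-trans : ∀ {x y z} → x ≤ y → y ≤ z → x ≤ z
  ≤-trans {x} (a , refl) (b , refl) = a ⌢ b , ⌢-assoc x a b

  -‿unique : ∀ {x y z} → y ≡ x ⌢ z → y - x ≡ z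
  -‿unique {x} {y} {z} e = ⌢-cancelˡ x (y - x) z (trans (sym (-‿≤ x y (z , e))) e)

  ⌢-monoʳ-≤ : ∀ u {t t'} → t ≤ t' → (u ⌢ t) ≤ (u ⌢ t')
  ⌢-monoʳ-≤ u {t} (d , refl) = d , sym (⌢-assoc u t d)

  ⌢-cancelˡ-≤ : ∀ u {t t'} → (u ⌢ t) ≤ (u ⌢ t') → t ≤ t'
  ⌢-cancelˡ-≤ u {t} {t'} (d , e) = d , ⌢-cancelˡ u t' (t ⌢ d) (trans e (⌢-assoc u t d))

  [u⌢t']-[u⌢t]≡t'-t : ∀ u {t t'} → t ≤ t' → (u ⌢ t') - (u ⌢ t) ≡ t' - t
  [u⌢t']-[u⌢t]≡t'-t u {t} (d , refl) = trans (-‿unique (sym (⌢-assoc u t d))) (sym (-‿unique refl))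

module RelationalAlgebra (T : TraceAlgebra) where
  open UTP T

  ≐-isEquivalence : IsEquivalence _≐_
  ≐-isEquivalence = record
    { refl  = λ _ _ → id , id
    ; sym   = λ e s s' → swap (e s s')
    ; trans = λ e f s s' → proj₁ (f s s') ∘ proj₁ (e s s') , proj₂ (e s s') ∘ proj₂ (f s s')
    }

  ≐-setoid : Setoid (lsuc 0ℓ) 0ℓ
  ≐-setoid = record { isEquivalence = ≐-isEquivalence }

  ⨾-congˡ : ∀ P {X Y} → X ≐ Y → (P ⨾ X) ≐ (P ⨾ Y)
  ⨾-congˡ P e s s' = (λ (s₀ , p , x) → s₀ , p , proj₁ (e s₀ s') x)
                   , (λ (s₀ , p , y) → s₀ , p , proj₂ (e s₀ s') y)

  ⨾-congʳ : ∀ Q {X Y} → X ≐ Y → (X ⨾ Q) ≐ (Y ⨾ Q)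
  ⨾-congʳ Q e s s' = (λ (s₀ , x , q) → s₀ , proj₁ (e s s₀) x , q)
                   , (λ (s₀ , y , q) → s₀ , proj₂ (e s s₀) y , q)

  ⨾-distribˡ-⋁ : ∀ P {I : Set} (A : I → Pred) → (P ⨾ ⋁ A) ≐ ⋁ (λ i → P ⨾ A i)
  ⨾-distribˡ-⋁ P A s s' = (λ (s₀ , p , i , a) → i , s₀ , p , a)
                        , (λ (i , s₀ , p , a) → s₀ , p , i , a)

  ⨾-distribʳ-⋁ : ∀ Q {I : Set} (A : I → Pred) → (⋁ A ⨾ Q) ≐ ⋁ (λ i → A i ⨾ Q)
  ⨾-distribʳ-⋁ Q A s s' = (λ (s₀ , (i , a) , q) → i , s₀ , a , q)
                        , (λ (i , s₀ , a , q) → s₀ , (i , a) , q)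

  ⨾-identityʳ : ∀ P → (P ⨾ II) ≐ P
  ⨾-identityʳ P s s' = (λ (s₀ , p , e) → subst (P s) (sym e) p) , (λ p → s' , p , refl)

  ⨾-identityˡ : ∀ P → (II ⨾ P) ≐ P
  ⨾-identityˡ P s s' = (λ (s₀ , e , p) → subst (λ x → P x s') e p) , (λ p → s , refl , p)

module Healthiness (T : TraceAlgebra) where
  open TraceAlgebra T
  open TraceAlgebraProperties T
  open RelationalAlgebra T
  open UTP T
  open Equivalence using (to; from)

  subst-traces : ∀ (X : Pred) {w w' a a' b b'} → a ≡ a' → b ≡ b' →
                 X (st w a) (st w' b) → X (st w a') (st w' b')
  subst-traces X {w} {w'} = subst₂ (λ a b → X (st w a) (st w' b))

  R-wait : ∀ (X : Pred) {t s'} → R X (st true t) s' → s' ≡ st true t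
  R-wait _ (inj₁ (_ , e))          = e
  R-wait _ (inj₂ (not-waiting , _)) = ⊥-elim (not-waiting refl)

  R-wait-intro : ∀ (X : Pred) {t s'} → s' ≡ st true t → R X (st true t) s'
  R-wait-intro _ e = inj₁ (refl , e)

  R-run : ∀ (X : Pred) {t w' t'} → R X (st false t) (st w' t') →
          t ≤ t' × X (st false ε) (st w' (t' - t))
  R-run _ (inj₁ (() , _))
  R-run _ (inj₂ (_ , inj₁ (t≤t' , x , _)))  = t≤t' , x
  R-run _ (inj₂ (_ , inj₂ (t≰t' , _ , t≤t'))) = ⊥-elim (t≰t' t≤t')

  R-run-intro : ∀ (X : Pred) {t w' t'} → t ≤ t' → X (st false ε) (st w' (t' - t)) →
                R X (st false t) (st w' t')
  R-run-intro _ {t = t} {t' = t'} t≤t' x =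
    inj₂ ((λ ()) , inj₁ (t≤t' , x , t' - t , sym (⌢-identityˡ (t' - t))))

  -- R3 is the first two fields, R1 the third, R2 the last.
  record Reactive (X : Pred) : Set where
    field
      wait-stays : ∀ {t s'} → X (st true t) s' → s' ≡ st true t
      wait-refl  : ∀ t → X (st true t) (st true t)
      tr-mono    : ∀ {s s'} → X s s' → tr s ≤ tr s'
      tr-shift   : ∀ u {w t w' t'} → X (st w t) (st w' t') ⇔ X (st w (u ⌢ t)) (st w' (u ⌢ t'))

  st-injective : ∀ {w t w' t'} → st w t ≡ st w' t' → w ≡ w' × t ≡ t'
  st-injective refl = refl , refl

  healthy⇒reactive : ∀ {X} → IsR X → Reactive X
  healthy⇒reactive {X} h = record
    { wait-stays = R-wait X ∘ unR
    ; wait-refl  = λ _ → toR (R-wait-intro X refl)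
    ; tr-mono    = mono
    ; tr-shift   = λ u → mk⇔ (shift u) (unshift u)
    }
    where
    toR : ∀ {s s'} → R X s s' → X s s'
    toR = proj₁ (h _ _)

    unR : ∀ {s s'} → X s s' → R X s s'
    unR = proj₂ (h _ _)

    mono : ∀ {s s'} → X s s' → tr s ≤ tr s'
    mono {st true _} x with R-wait X (unR x)
    ... | refl = ≤-refl
    mono {st false _} {st _ _} x = proj₁ (R-run X (unR x))

    shift : ∀ u {w t w' t'} → X (st w t) (st w' t') → X (st w (u ⌢ t)) (st w' (u ⌢ t'))
    shift u {true} x with R-wait X (unR x)
    ... | refl = toR (R-wait-intro X refl)
    shift u {false} {w' = w'} x with R-run X (unR x)
    ... | t≤t' , k = toR (R-run-intro X (⌢-monoʳ-≤ u t≤t')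
                      (subst (X (st false ε) ∘ st w') (sym ([u⌢t']-[u⌢t]≡t'-t u t≤t')) k))

    unshift : ∀ u {w t w' t'} → X (st w (u ⌢ t)) (st w' (u ⌢ t')) → X (st w t) (st w' t')
    unshift u {true} {t} {t' = t'} x with st-injective (R-wait X (unR x))
    ... | refl , e rewrite ⌢-cancelˡ u t' t e = toR (R-wait-intro X refl)
    unshift u {false} {w' = w'} x with R-run X (unR x)
    ... | ut≤ut' , k = toR (R-run-intro X t≤t'
                        (subst (X (st false ε) ∘ st w') ([u⌢t']-[u⌢t]≡t'-t u t≤t') k))
      where t≤t' = ⌢-cancelˡ-≤ u ut≤ut'

  reactive⇒healthy : ∀ {X} → Reactive X → IsR X
  reactive⇒healthy {X} r (st true t) s' =
    (λ x → subst (X (st true t)) (sym (R-wait X x)) (wait-refl t)) , R-wait-intro X ∘ wait-stays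
    where open Reactive r
  reactive⇒healthy {X} r (st false t) (st w' t') =
    (λ x → let (t≤t' , k) = R-run X x in
             subst-traces X (⌢-identityʳ t) (sym (-‿≤ t t' t≤t')) (to (tr-shift t) k))
    , (λ x → let t≤t' = tr-mono x in
             R-run-intro X t≤t' (from (tr-shift t)
               (subst-traces X (sym (⌢-identityʳ t)) (-‿≤ t t' t≤t') x)))
    where open Reactive r

  ⨾-reactive : ∀ {P Q} → Reactive P → Reactive Q → Reactive (P ⨾ Q)
  ⨾-reactive {P} {Q} rP rQ = record
    { wait-stays = stays
    ; wait-refl  = λ t → st true t , Pʳ.wait-refl t , Qʳ.wait-refl t
    ; tr-mono    = λ (_ , p , q) → ≤-trans (Pʳ.tr-mono p) (Qʳ.tr-mono q)
    ; tr-shift   = λ u → mk⇔ (shift u) (unshift u)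
    }
    where
    module Pʳ = Reactive rP
    module Qʳ = Reactive rQ

    stays : ∀ {t s'} → (P ⨾ Q) (st true t) s' → s' ≡ st true t
    stays (_ , p , q) with Pʳ.wait-stays p
    ... | refl = Qʳ.wait-stays q

    shift : ∀ u {w t w' t'} → (P ⨾ Q) (st w t) (st w' t') →
            (P ⨾ Q) (st w (u ⌢ t)) (st w' (u ⌢ t'))
    shift u (st w₀ t₀ , p , q) = st w₀ (u ⌢ t₀) , to (Pʳ.tr-shift u) p , to (Qʳ.tr-shift u) q

    -- The intermediate trace extends u ⌢ t, hence u, so it can be unshifted too.
    unshift : ∀ u {w t w' t'} → (P ⨾ Q) (st w (u ⌢ t)) (st w' (u ⌢ t')) →
              (P ⨾ Q) (st w t) (st w' t')
    unshift u {t = t} (st w₀ t₀ , p , q) =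
      st w₀ (t₀ - u) , from (Pʳ.tr-shift u) (subst-traces P refl t₀≡u⌢t₀-u p)
                     , from (Qʳ.tr-shift u) (subst-traces Q t₀≡u⌢t₀-u refl q)
      where
      t₀≡u⌢t₀-u : t₀ ≡ u ⌢ (t₀ - u)
      t₀≡u⌢t₀-u = -‿≤ u t₀ (≤-trans (t , refl) (Pʳ.tr-mono p))

  ⋁-reactive : ∀ {I : Set} {A : I → Pred} → I → (∀ i → Reactive (A i)) → Reactive (⋁ A)
  ⋁-reactive i₀ r = record
    { wait-stays = λ (i , a) → wait-stays (r i) a
    ; wait-refl  = λ t → i₀ , wait-refl (r i₀) t
    ; tr-mono    = λ (i , a) → tr-mono (r i) a
    ; tr-shift   = λ u → mk⇔ (λ (i , a) → i , to (tr-shift (r i) u) a)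
                             (λ (i , a) → i , from (tr-shift (r i) u) a)
    }
    where open Reactive

  IsR-⨾ : ∀ {P Q} → IsR P → IsR Q → IsR (P ⨾ Q)
  IsR-⨾ hP hQ = reactive⇒healthy (⨾-reactive (healthy⇒reactive hP) (healthy⇒reactive hQ))

  IsR-⋁ : ∀ {I : Set} {A : I → Pred} → I → (∀ i → IsR (A i)) → IsR (⋁ A)
  IsR-⋁ i₀ hA = reactive⇒healthy (⋁-reactive i₀ (healthy⇒reactive ∘ hA))

  open import Relation.Binary.Reasoning.Setoid ≐-setoid

  ⨾-distribˡ-R⋁ : ∀ (P : Pred) {I : Set} (A : I → Pred) → IsR P → I → (∀ i → IsR (A i)) →
                  (P ⨾ R (⋁ A)) ≐ R (⋁ (λ i → P ⨾ A i))
  ⨾-distribˡ-R⋁ P A hP i₀ hA = begin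
    P ⨾ R (⋁ A)             ≈⟨ ⨾-congˡ P (IsR-⋁ i₀ hA) ⟩
    P ⨾ ⋁ A                 ≈⟨ ⨾-distribˡ-⋁ P A ⟩
    ⋁ (λ i → P ⨾ A i)       ≈⟨ IsR-⋁ i₀ (λ i → IsR-⨾ hP (hA i)) ⟨
    R (⋁ (λ i → P ⨾ A i))   ∎

  ⨾-distribʳ-R⋁ : ∀ (Q : Pred) {I : Set} (A : I → Pred) → IsR Q → I → (∀ i → IsR (A i)) →
                  (R (⋁ A) ⨾ Q) ≐ R (⋁ (λ i → A i ⨾ Q))
  ⨾-distribʳ-R⋁ Q A hQ i₀ hA = begin
    R (⋁ A) ⨾ Q             ≈⟨ ⨾-congʳ Q (IsR-⋁ i₀ hA) ⟩
    ⋁ A ⨾ Q                 ≈⟨ ⨾-distribʳ-⋁ Q A ⟩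
    ⋁ (λ i → A i ⨾ Q)       ≈⟨ IsR-⋁ i₀ (λ i → IsR-⨾ (hA i) hQ) ⟨
    R (⋁ (λ i → A i ⨾ Q))   ∎

theorem14 : (T : TraceAlgebra) → let open UTP T in
    (∀ (P : Pred) {I : Set} (A : I → Pred) → IsR P → I → (∀ i → IsR (A i)) →
      (P ⨾ R (⋁ A)) ≐ R (⋁ (λ i → P ⨾ A i)))
    ×
    (∀ (Q : Pred) {I : Set} (A : I → Pred) → IsR Q → I → (∀ i → IsR (A i)) →
      (R (⋁ A) ⨾ Q) ≐ R (⋁ (λ i → A i ⨾ Q)))
    ×
    (∀ (P : Pred) → IsR P → ((P ⨾ II) ≐ P) × ((II ⨾ P) ≐ P))
theorem14 T = ⨾-distribˡ-R⋁ , ⨾-distribʳ-R⋁ , λ P _ → ⨾-identityʳ P , ⨾-identityˡ P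
  where
  open RelationalAlgebra T
  open Healthiness T
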